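{- A graph $G=(V,E)$ is a two-factor if and only if $\sigma(G)=|V|$.
   Context: All graphs are finite, simple and undirected. A two-factor is a graph in which every vertex has degree exactly two. An edge coloring of $G$ with $k$ colors is a surjective map $c:E\to[k]$; it is $2$-valid if for every vertex $v$ the edges incident to $v$ receive at most $2$ distinct colors. $\sigma(G)$ denotes the largest integer $k$ for which $G$ has a $2$-valid edge coloring with $k$ colors. -}

module Defs where

open import Data.Nat using (ℕ; _≤_)
open import Data.Fin using (Fin; _<_)
open import Data.Bool using (Bool; true; false; T)
open import Data.List using (length; filter)
open import Data.List.Base using (allFin)
open import Data.Product using (Σ; ∃; _×_; _,_)
open import Data.Sum using (_⊎_)
open import Relation.Binary.PropositionalEquality using (_≡_; _≢_)
open import Relation.Nullary.Decidable using (T?)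
open import Relation.Nullary using (¬_)

record Graph (n : ℕ) : Set where
  field
    adj   : Fin n → Fin n → Bool
    sym   : ∀ i j → adj i j ≡ adj j i
    irrefl : ∀ i → adj i i ≡ false
open Graph public

degree : ∀ {n} → Graph n → Fin n → ℕ
degree G v = length (filter (λ w → T? (adj G v w)) (allFin _))

IsTwoFactor : ∀ {n} → Graph n → Set
IsTwoFactor {n} G = ∀ (v : Fin n) → degree G v ≡ 2

-- an edge {i,j} is represented uniquely by the pair (i , j) with i < j
Edge : ∀ {n} → Graph n → Set
Edge {n} G = Σ (Fin n × Fin n) λ { (i , j) → (i < j) × T (adj G i j) }

IncidentTo : ∀ {n} (G : Graph n) → Fin n → Edge G → Set
IncidentTo G v ((i , j) , _) = (v ≡ i) ⊎ (v ≡ j)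

record EdgeColoring {n} (G : Graph n) (k : ℕ) : Set where
  field
    col  : Edge G → Fin k
    surj : ∀ (a : Fin k) → ∃ λ (e : Edge G) → col e ≡ a
open EdgeColoring public

-- 2-valid: at every vertex the incident edges use at most 2 distinct colours,
-- i.e. no three incident edges carry pairwise distinct colours
TwoValid : ∀ {n} {G : Graph n} {k : ℕ} → EdgeColoring G k → Set
TwoValid {n} {G} c =
  ∀ (v : Fin n) (e₁ e₂ e₃ : Edge G) →
    IncidentTo G v e₁ → IncidentTo G v e₂ → IncidentTo G v e₃ →
    ¬ ((col c e₁ ≢ col c e₂) × (col c e₂ ≢ col c e₃) × (col c e₁ ≢ col c e₃))

HasTwoValidColoring : ∀ {n} → Graph n → ℕ → Set
HasTwoValidColoring G k = Σ (EdgeColoring G k) TwoValid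

SigmaIs : ∀ {n} → Graph n → ℕ → Set
SigmaIs G k = HasTwoValidColoring G k × (∀ k′ → HasTwoValidColoring G k′ → k′ ≤ k)

-- Fix a 2-valid coloring with k colors and, for every color a, an edge of color a.  At most
-- two colors occur at a vertex v, so a color at v is determined by one bit, slot v a, telling
-- whether it is the color of the edge from v to a fixed neighbour.  Sending a color and an end
-- of its chosen edge to that end and the slot is therefore an injection
-- Fin k × Fin 2 → Fin n × Fin 2, so σ(G) ≤ n.
-- If k = n this injection is a bijection.  Then every edge is the chosen edge of its own color, so
-- the coloring is rainbow and 2-validity leaves at most two edges at each vertex, while the two
-- half-edges over v provide two distinct colors at v: every degree is 2.  Conversely, the rainbow
-- coloring of a two-factor is 2-valid and its half-edge map is onto, so |E| = n and σ(G) = n.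

module Submission where

open import Defs hiding (sym)
open import Data.Nat using (ℕ; zero; suc; _*_; _≤_; NonZero)
open import Data.Nat.Properties using (*-cancelʳ-≤; ≤-antisym; 1+n≰n)
open import Data.Fin using (Fin; zero; suc; punchOut; opposite; _≟_; _<_; _<?_)
open import Data.Fin.Properties
  using (any?; punchOut-injective; injective⇒≤; *↔×; <-irrelevant; <-irrefl; <-asym; <-cmp)
open import Data.Bool using (T)
open import Data.Bool.Properties using (T-irrelevant)
open import Data.List using (List; []; _∷_; length; filter; lookup; allFin; cartesianProduct)
open import Data.List.Membership.Propositional using (_∈_)
open import Data.List.Membership.Propositional.Properties
  using (∈-filter⁺; ∈-filter⁻; ∈-lookup; ∈-allFin; ∈-cartesianProduct⁺)
open import Data.List.Relation.Unary.All as All using ([]; _∷_)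
open import Data.List.Relation.Unary.Any using (here; there; index)
open import Data.List.Relation.Unary.Any.Properties using (lookup-index)
open import Data.List.Relation.Unary.AllPairs using (_∷_)
open import Data.List.Relation.Unary.Unique.Propositional using (Unique)
import Data.List.Relation.Unary.Unique.Propositional.Properties as Unique
open import Data.Product using (Σ; ∃; ∃₂; _×_; _,_; proj₁; proj₂)
open import Data.Sum using (_⊎_; inj₁; inj₂; [_,_]′)
open import Function using (_∘_; _↔_; Inverse; Injection; Equivalence; mk↔ₛ′; _⇔_; mk⇔)
open import Function.Properties.Inverse using (↔-sym; Inverse⇒Injection)
open import Function.Properties.Equivalence using () renaming (trans to ⇔-trans)
open import Function.Definitions using (Injective; StrictlySurjective)
open import Relation.Binary.PropositionalEquality
  using (_≡_; _≢_; refl; sym; trans; cong; cong₂; subst; subst₂; module ≡-Reasoning)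
open import Relation.Binary.Definitions using (tri<; tri≈; tri>)
open import Relation.Nullary using (¬_; yes; no; contradiction)
open import Relation.Nullary.Decidable using (T?; _×-dec_)
open import Relation.Unary using (Decidable; Irrelevant)

open ≡-Reasoning

injective⇒strictlySurjective : ∀ {m} {f : Fin m → Fin m} →
  Injective _≡_ _≡_ f → StrictlySurjective _≡_ f
injective⇒strictlySurjective {zero} _ ()
injective⇒strictlySurjective {suc m} {f} f-injective y with any? (λ x → f x ≟ y)
... | yes hit = hit
... | no miss = contradiction (injective⇒≤ {f = g} g-injective) 1+n≰n
  where
  y≢f : ∀ x → y ≢ f x
  y≢f x eq = miss (x , sym eq)
  g : Fin (suc m) → Fin m
  g x = punchOut (y≢f x)
  g-injective : Injective _≡_ _≡_ g
  g-injective eq = f-injective (punchOut-injective (y≢f _) (y≢f _) eq)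

↔-to-injective : ∀ {A B : Set} (A↔B : A ↔ B) → Injective _≡_ _≡_ (Inverse.to A↔B)
↔-to-injective A↔B = Injection.injective (Inverse⇒Injection A↔B)

flatten : ∀ {a b c} → (Fin a × Fin c → Fin b × Fin c) → Fin (a * c) → Fin (b * c)
flatten f = Inverse.from *↔× ∘ f ∘ Inverse.to *↔×

flatten-injective : ∀ {a b c} {f : Fin a × Fin c → Fin b × Fin c} →
  Injective _≡_ _≡_ f → Injective _≡_ _≡_ (flatten f)
flatten-injective f-injective = ↔-to-injective *↔× ∘ f-injective ∘ ↔-to-injective (↔-sym *↔×)

×-injective⇒≤ : ∀ {a b c} .{{_ : NonZero c}} {f : Fin a × Fin c → Fin b × Fin c} →
  Injective _≡_ _≡_ f → a ≤ b
×-injective⇒≤ {a} {b} {c} = *-cancelʳ-≤ a b c ∘ injective⇒≤ ∘ flatten-injective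

×-strictlySurjective⇒≥ : ∀ {a b c} .{{_ : NonZero c}} {f : Fin a × Fin c → Fin b × Fin c} →
  StrictlySurjective _≡_ f → b ≤ a
×-strictlySurjective⇒≥ {a} {b} {c} {f} f-surjective = ×-injective⇒≤ {f = section} section-injective
  where
  section : Fin b × Fin c → Fin a × Fin c
  section = proj₁ ∘ f-surjective
  section-injective : Injective _≡_ _≡_ section
  section-injective {y} {y′} eq =
    trans (sym (proj₂ (f-surjective y))) (trans (cong f eq) (proj₂ (f-surjective y′)))

×-injective⇒strictlySurjective : ∀ {a c} {f : Fin a × Fin c → Fin a × Fin c} →
  Injective _≡_ _≡_ f → StrictlySurjective _≡_ f
×-injective⇒strictlySurjective {a} {c} {f} f-injective y = to x , (begin
  f (to x)               ≡⟨ sym (strictlyInverseˡ (f (to x))) ⟩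
  to (flatten f x)       ≡⟨ cong to flatten-x≡y ⟩
  to (from y)            ≡⟨ strictlyInverseˡ y ⟩
  y                      ∎)
  where
  open Inverse (*↔× {a} {c})
  hit : ∃ λ x → flatten f x ≡ from y
  hit = injective⇒strictlySurjective (flatten-injective f-injective) (from y)
  x : Fin (a * c)
  x = proj₁ hit
  flatten-x≡y : flatten f x ≡ from y
  flatten-x≡y = proj₂ hit

lookup-injective : ∀ {A : Set} {xs : List A} → Unique xs → Injective _≡_ _≡_ (lookup xs)
lookup-injective {xs = _ ∷ _} _            {zero}  {zero}  _  = refl
lookup-injective {xs = _ ∷ _} (x∉xs ∷ _)   {zero}  {suc j} eq =
  contradiction eq (All.lookup x∉xs (∈-lookup j))
lookup-injective {xs = _ ∷ _} (x∉xs ∷ _)   {suc i} {zero}  eq =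
  contradiction (sym eq) (All.lookup x∉xs (∈-lookup i))
lookup-injective {xs = _ ∷ _} (_ ∷ unique) {suc i} {suc j} eq =
  cong suc (lookup-injective unique eq)

proj₁-injective : ∀ {A : Set} {P : A → Set} → Irrelevant P →
  Injective _≡_ _≡_ (proj₁ {B = P})
proj₁-injective P-irrelevant {x , px} {.x , qx} refl = cong (x ,_) (P-irrelevant px qx)

module _ {A : Set} {P : A → Set} (P? : Decidable P) (P-irrelevant : Irrelevant P)
         {xs : List A} (xs-unique : Unique xs) (xs-complete : ∀ x → x ∈ xs) where

  Σ↔Fin-length-filter : Σ A P ↔ Fin (length (filter P? xs))
  Σ↔Fin-length-filter = mk↔ₛ′ to from to∘from from∘to
    where
    to : Σ A P → Fin (length (filter P? xs))
    to (x , px) = index (∈-filter⁺ P? (xs-complete x) px)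

    from : Fin (length (filter P? xs)) → Σ A P
    from i = lookup (filter P? xs) i , proj₂ (∈-filter⁻ P? {xs = xs} (∈-lookup i))

    to∘from : ∀ i → to (from i) ≡ i
    to∘from i = lookup-injective (Unique.filter⁺ P? xs-unique)
      (sym (lookup-index (∈-filter⁺ P? (xs-complete _) (proj₂ (from i)))))

    from∘to : ∀ x → from (to x) ≡ x
    from∘to (x , px) = proj₁-injective P-irrelevant
      (sym (lookup-index (∈-filter⁺ P? (xs-complete x) px)))

Distinct₃ : ∀ {A : Set} → A → A → A → Set
Distinct₃ x y z = x ≢ y × y ≢ z × x ≢ z

module _ {A B : Set} where

  Distinct₃-map⁺ : ∀ {f : A → B} → Injective _≡_ _≡_ f →
    ∀ {x y z} → Distinct₃ x y z → Distinct₃ (f x) (f y) (f z)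
  Distinct₃-map⁺ f-injective (x≢y , y≢z , x≢z) =
    x≢y ∘ f-injective , y≢z ∘ f-injective , x≢z ∘ f-injective

  Distinct₃-map⁻ : ∀ (f : A → B) {x y z} → Distinct₃ (f x) (f y) (f z) → Distinct₃ x y z
  Distinct₃-map⁻ f (fx≢fy , fy≢fz , fx≢fz) = fx≢fy ∘ cong f , fy≢fz ∘ cong f , fx≢fz ∘ cong f

module _ {A : Set} where

  AtLeastTwo : (A → Set) → Set
  AtLeastTwo P = ∃₂ λ x y → x ≢ y × P x × P y

  AtMostTwo : (A → Set) → Set
  AtMostTwo P = ∀ x y z → P x → P y → P z → ¬ Distinct₃ x y z

  ExactlyTwo : (A → Set) → Set
  ExactlyTwo P = AtLeastTwo P × AtMostTwo P

record Embedding {A B : Set} (P : A → Set) (Q : B → Set) : Set where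
  field
    embed           : ∀ x → P x → B
    embed-satisfies : ∀ x (px : P x) → Q (embed x px)
    embed-injective : ∀ x y (px : P x) (py : P y) → embed x px ≡ embed y py → x ≡ y

module _ {A B : Set} {P : A → Set} {Q : B → Set} where

  AtLeastTwo-map : Embedding P Q → AtLeastTwo P → AtLeastTwo Q
  AtLeastTwo-map P↪Q (x , y , x≢y , px , py) =
    embed x px , embed y py , x≢y ∘ embed-injective x y px py ,
    embed-satisfies x px , embed-satisfies y py
    where open Embedding P↪Q

  AtMostTwo-pull : Embedding P Q → AtMostTwo Q → AtMostTwo P
  AtMostTwo-pull P↪Q at-most x y z px py pz (x≢y , y≢z , x≢z) =
    at-most _ _ _ (embed-satisfies x px) (embed-satisfies y py) (embed-satisfies z pz)
      (x≢y ∘ embed-injective x y px py , y≢z ∘ embed-injective y z py pz ,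
       x≢z ∘ embed-injective x z px pz)
    where open Embedding P↪Q

ExactlyTwo-cong : ∀ {A B : Set} {P : A → Set} {Q : B → Set} →
  Embedding P Q → Embedding Q P → ExactlyTwo P ⇔ ExactlyTwo Q
ExactlyTwo-cong P↪Q Q↪P =
  mk⇔ (λ (two , at-most) → AtLeastTwo-map P↪Q two , AtMostTwo-pull Q↪P at-most)
      (λ (two , at-most) → AtLeastTwo-map Q↪P two , AtMostTwo-pull P↪Q at-most)

module _ {A : Set} where

  ∈-pair⁻ : ∀ {x y z : A} → z ∈ x ∷ y ∷ [] → z ≡ x ⊎ z ≡ y
  ∈-pair⁻ (here z≡x)         = inj₁ z≡x
  ∈-pair⁻ (there (here z≡y)) = inj₂ z≡y
  ∈-pair⁻ (there (there ()))

  pair-atMostTwo : ∀ {x y : A} → AtMostTwo (_∈ x ∷ y ∷ [])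
  pair-atMostTwo _ _ _ p∈ q∈ r∈ (p≢q , q≢r , p≢r) with ∈-pair⁻ p∈ | ∈-pair⁻ q∈ | ∈-pair⁻ r∈
  ... | inj₁ refl | inj₁ refl | _         = p≢q refl
  ... | inj₂ refl | inj₂ refl | _         = p≢q refl
  ... | inj₁ refl | inj₂ refl | inj₁ refl = p≢r refl
  ... | inj₁ refl | inj₂ refl | inj₂ refl = q≢r refl
  ... | inj₂ refl | inj₁ refl | inj₁ refl = q≢r refl
  ... | inj₂ refl | inj₁ refl | inj₂ refl = p≢r refl

  length≡2⇔ : ∀ {xs : List A} → Unique xs → length xs ≡ 2 ⇔ ExactlyTwo (_∈ xs)
  length≡2⇔ unique = mk⇔ (to unique) (from unique)
    where
    to : ∀ {xs} → Unique xs → length xs ≡ 2 → ExactlyTwo (_∈ xs)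
    to {x ∷ y ∷ []} ((x≢y ∷ []) ∷ _) refl =
      (x , y , x≢y , here refl , there (here refl)) , pair-atMostTwo
    from : ∀ {xs} → Unique xs → ExactlyTwo (_∈ xs) → length xs ≡ 2
    from {[]}              _ ((_ , _ , _ , () , _) , _)
    from {_ ∷ []}          _ ((_ , _ , x≢y , here refl , here refl) , _) = contradiction refl x≢y
    from {_ ∷ []}          _ ((_ , _ , _ , there () , _) , _)
    from {_ ∷ []}          _ ((_ , _ , _ , _ , there ()) , _)
    from {_ ∷ _ ∷ []}      _ _ = refl
    from {_ ∷ _ ∷ _ ∷ _} ((p≢q ∷ p≢r ∷ _) ∷ (q≢r ∷ _) ∷ _) (_ , at-most) =
      contradiction (p≢q , q≢r , p≢r)
        (at-most _ _ _ (here refl) (there (here refl)) (there (there (here refl))))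

Fin2-≢⇒≡⊎≡ : ∀ {s s′ : Fin 2} → s ≢ s′ → ∀ t → t ≡ s ⊎ t ≡ s′
Fin2-≢⇒≡⊎≡ {zero}     {zero}     s≢s′ _          = contradiction refl s≢s′
Fin2-≢⇒≡⊎≡ {zero}     {suc zero} _    zero       = inj₁ refl
Fin2-≢⇒≡⊎≡ {zero}     {suc zero} _    (suc zero) = inj₂ refl
Fin2-≢⇒≡⊎≡ {suc zero} {zero}     _    zero       = inj₂ refl
Fin2-≢⇒≡⊎≡ {suc zero} {zero}     _    (suc zero) = inj₁ refl
Fin2-≢⇒≡⊎≡ {suc zero} {suc zero} s≢s′ _          = contradiction refl s≢s′

≢-opposite : ∀ (s : Fin 2) → s ≢ opposite s
≢-opposite zero ()
≢-opposite (suc zero) ()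

module _ {n : ℕ} (G : Graph n) where

  Adjacent : Fin n → Fin n → Set
  Adjacent v w = T (adj G v w)

  Neighbour : Fin n → Set
  Neighbour v = Σ (Fin n) (Adjacent v)

  adjacent⇒≢ : ∀ {v w} → Adjacent v w → v ≢ w
  adjacent⇒≢ {v} v~w refl = subst T (irrefl G v) v~w

  IsEdge : Fin n × Fin n → Set
  IsEdge (i , j) = (i < j) × Adjacent i j

  IsEdge-irrelevant : Irrelevant IsEdge
  IsEdge-irrelevant (i<j , i~j) (i<j′ , i~j′) =
    cong₂ _,_ (<-irrelevant i<j i<j′) (T-irrelevant i~j i~j′)

  IsEdge? : Decidable IsEdge
  IsEdge? (i , j) = i <? j ×-dec T? (adj G i j)

  edgeCount : ℕ
  edgeCount = length (filter IsEdge? (cartesianProduct (allFin n) (allFin n)))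

  Edge↔Fin : Edge G ↔ Fin edgeCount
  Edge↔Fin = Σ↔Fin-length-filter IsEdge? IsEdge-irrelevant
    (Unique.cartesianProduct⁺ (Unique.allFin⁺ n) (Unique.allFin⁺ n))
    (λ (i , j) → ∈-cartesianProduct⁺ (∈-allFin i) (∈-allFin j))

  endpoint : Edge G → Fin 2 → Fin n
  endpoint ((i , _) , _) zero       = i
  endpoint ((_ , j) , _) (suc zero) = j

  endpoint-incident : ∀ e s → IncidentTo G (endpoint e s) e
  endpoint-incident _ zero       = inj₁ refl
  endpoint-incident _ (suc zero) = inj₂ refl

  incident⇒endpoint : ∀ {v e} → IncidentTo G v e → ∃ λ s → endpoint e s ≡ v
  incident⇒endpoint (inj₁ refl) = zero , refl
  incident⇒endpoint (inj₂ refl) = suc zero , refl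

  endpoint-adjacent : ∀ e s → Adjacent (endpoint e s) (endpoint e (opposite s))
  endpoint-adjacent ((i , j) , _ , i~j) zero       = i~j
  endpoint-adjacent ((i , j) , _ , i~j) (suc zero) = subst T (Graph.sym G i j) i~j

  endpoint-injective : ∀ e → Injective _≡_ _≡_ (endpoint e)
  endpoint-injective _ {zero}     {zero}     _  = refl
  endpoint-injective _ {suc zero} {suc zero} _  = refl
  endpoint-injective (_ , i<j , _) {zero}     {suc zero} i≡j = contradiction i<j (<-irrefl i≡j)
  endpoint-injective (_ , i<j , _) {suc zero} {zero}     j≡i = contradiction i<j (<-irrefl (sym j≡i))

  endpoints⊆⇒≡ : ∀ {e e′} → (∀ s → ∃ λ t → endpoint e′ t ≡ endpoint e s) → e ≡ e′
  endpoints⊆⇒≡ {(i , j) , i<j , _} {(i′ , j′) , i′<j′ , _} covered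
    with covered zero | covered (suc zero)
  ... | zero     , i′≡i | suc zero , j′≡j =
    proj₁-injective IsEdge-irrelevant (sym (cong₂ _,_ i′≡i j′≡j))
  ... | suc zero , j′≡i | zero     , i′≡j = contradiction (subst₂ _<_ i′≡j j′≡i i′<j′) (<-asym i<j)
  ... | zero     , i′≡i | zero     , i′≡j = contradiction i<j (<-irrefl (trans (sym i′≡i) i′≡j))
  ... | suc zero , j′≡i | suc zero , j′≡j = contradiction i<j (<-irrefl (trans (sym j′≡i) j′≡j))

  edgeTo : ∀ v → Neighbour v → Edge G
  edgeTo v (w , v~w) with <-cmp v w
  ... | tri< v<w _ _ = (v , w) , v<w , v~w
  ... | tri≈ _ v≡w _ = contradiction v≡w (adjacent⇒≢ v~w)
  ... | tri> _ _ w<v = (w , v) , w<v , subst T (Graph.sym G v w) v~w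

  edgeTo-endpoints : ∀ v w →
    ∃ λ s → endpoint (edgeTo v w) s ≡ v × endpoint (edgeTo v w) (opposite s) ≡ proj₁ w
  edgeTo-endpoints v (w , v~w) with <-cmp v w
  ... | tri< _ _ _   = zero , refl , refl
  ... | tri≈ _ v≡w _ = contradiction v≡w (adjacent⇒≢ v~w)
  ... | tri> _ _ _   = suc zero , refl , refl

  edgeTo-endpoint : ∀ v w t → endpoint (edgeTo v w) t ≡ v ⊎ endpoint (edgeTo v w) t ≡ proj₁ w
  edgeTo-endpoint v w t with edgeTo-endpoints v w
  ... | s , ends-v , ends-w with Fin2-≢⇒≡⊎≡ (≢-opposite s) t
  ...   | inj₁ refl = inj₁ ends-v
  ...   | inj₂ refl = inj₂ ends-w

  edgeTo-incident : ∀ v w → IncidentTo G v (edgeTo v w)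
  edgeTo-incident v w with edgeTo-endpoints v w
  ... | s , ends-v , _ = subst (λ u → IncidentTo G u (edgeTo v w)) ends-v (endpoint-incident _ s)

  edgeTo-injective : ∀ v → Injective _≡_ _≡_ (edgeTo v)
  edgeTo-injective v {x , v~x} {y , v~y} eq with s , _ , ends-x ← edgeTo-endpoints v (x , v~x) =
    proj₁-injective T-irrelevant
      ([ (λ ≡v → contradiction (sym (trans x≡ ≡v)) (adjacent⇒≢ v~x)) , trans x≡ ]′
       (edgeTo-endpoint v (y , v~y) (opposite s)))
    where
    x≡ : x ≡ endpoint (edgeTo v (y , v~y)) (opposite s)
    x≡ = trans (sym ends-x) (cong (λ e → endpoint e (opposite s)) eq)

  incident⇒edgeTo : ∀ {v} e → IncidentTo G v e → ∃ λ w → edgeTo v w ≡ e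
  incident⇒edgeTo {v} e v∈e with incident⇒endpoint v∈e
  ... | s , ends = w , endpoints⊆⇒≡ λ t →
        [ (λ eq → s , trans ends (sym eq)) , (λ eq → opposite s , sym eq) ]′ (edgeTo-endpoint v w t)
    where
    w : Neighbour v
    w = endpoint e (opposite s) , subst (λ u → Adjacent u _) ends (endpoint-adjacent e s)

  neighbour⇒incident : ∀ v → Embedding (Adjacent v) (IncidentTo G v)
  neighbour⇒incident v = record
    { embed           = λ w v~w → edgeTo v (w , v~w)
    ; embed-satisfies = λ w v~w → edgeTo-incident v (w , v~w)
    ; embed-injective = λ _ _ _ _ → cong proj₁ ∘ edgeTo-injective v
    }

  incident⇒neighbour : ∀ v → Embedding (IncidentTo G v) (Adjacent v)
  incident⇒neighbour v = record
    { embed           = λ e v∈e → proj₁ (neighbour e v∈e)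
    ; embed-satisfies = λ e v∈e → proj₂ (neighbour e v∈e)
    ; embed-injective = λ e e′ v∈e v∈e′ eq → begin
        e                            ≡⟨ sym (proj₂ (incident⇒edgeTo e v∈e)) ⟩
        edgeTo v (neighbour e v∈e)   ≡⟨ cong (edgeTo v) (proj₁-injective T-irrelevant eq) ⟩
        edgeTo v (neighbour e′ v∈e′) ≡⟨ proj₂ (incident⇒edgeTo e′ v∈e′) ⟩
        e′                           ∎
    }
    where
    neighbour : ∀ e → IncidentTo G v e → Neighbour v
    neighbour e = proj₁ ∘ incident⇒edgeTo e

  degree≡2⇔ : ∀ v → degree G v ≡ 2 ⇔ ExactlyTwo (IncidentTo G v)
  degree≡2⇔ v =
    ⇔-trans (length≡2⇔ (Unique.filter⁺ Adjacent? (Unique.allFin⁺ n)))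
   (⇔-trans (ExactlyTwo-cong member⇒neighbour neighbour⇒member)
            (ExactlyTwo-cong (neighbour⇒incident v) (incident⇒neighbour v)))
    where
    Adjacent? : Decidable (Adjacent v)
    Adjacent? w = T? (adj G v w)
    member⇒neighbour : Embedding (_∈ filter Adjacent? (allFin n)) (Adjacent v)
    member⇒neighbour = record
      { embed           = λ w _ → w
      ; embed-satisfies = λ _ → proj₂ ∘ ∈-filter⁻ Adjacent? {xs = allFin n}
      ; embed-injective = λ _ _ _ _ eq → eq
      }
    neighbour⇒member : Embedding (Adjacent v) (_∈ filter Adjacent? (allFin n))
    neighbour⇒member = record
      { embed           = λ w _ → w
      ; embed-satisfies = λ w → ∈-filter⁺ Adjacent? (∈-allFin w)
      ; embed-injective = λ _ _ _ _ eq → eq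
      }

module _ {n : ℕ} {G : Graph n} {k : ℕ} (c : EdgeColoring G k) where

  representative : Fin k → Edge G
  representative a = proj₁ (surj c a)

  col-representative : ∀ a → col c (representative a) ≡ a
  col-representative a = proj₂ (surj c a)

  atMostTwoEdges⇒twoValid : (∀ v → AtMostTwo (IncidentTo G v)) → TwoValid c
  atMostTwoEdges⇒twoValid at-most v e₁ e₂ e₃ v∈e₁ v∈e₂ v∈e₃ =
    at-most v e₁ e₂ e₃ v∈e₁ v∈e₂ v∈e₃ ∘ Distinct₃-map⁻ (col c)

  rainbow-twoValid⇒atMostTwoEdges : Injective _≡_ _≡_ (col c) → TwoValid c →
    ∀ v → AtMostTwo (IncidentTo G v)
  rainbow-twoValid⇒atMostTwoEdges rainbow valid v e₁ e₂ e₃ v∈e₁ v∈e₂ v∈e₃ =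
    valid v e₁ e₂ e₃ v∈e₁ v∈e₂ v∈e₃ ∘ Distinct₃-map⁺ rainbow

  module _ (valid : TwoValid c) where

    slot : Fin n → Fin k → Fin 2
    slot v a with any? (λ w → T? (adj G v w))
    ... | no  _ = zero
    ... | yes w with a ≟ col c (edgeTo G v w)
    ...   | yes _ = zero
    ...   | no  _ = suc zero

    slot-injective : ∀ {v} e e′ → IncidentTo G v e → IncidentTo G v e′ →
      slot v (col c e) ≡ slot v (col c e′) → col c e ≡ col c e′
    slot-injective {v} e e′ v∈e v∈e′ same with any? (λ w → T? (adj G v w))
    ... | no ∄w = contradiction (proj₁ (incident⇒edgeTo G e v∈e)) ∄w
    ... | yes w with col c e ≟ col c (edgeTo G v w) | col c e′ ≟ col c (edgeTo G v w)
    ...   | yes e≡w | yes e′≡w = trans e≡w (sym e′≡w)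
    ...   | no  e≢w | no  e′≢w with col c e ≟ col c e′
    ...     | yes e≡e′ = e≡e′
    ...     | no  e≢e′ = contradiction (e≢e′ , e′≢w , e≢w)
                           (valid v e e′ (edgeTo G v w) v∈e v∈e′ (edgeTo-incident G v w))
    slot-injective _ _ _ _ () | yes _ | yes _ | no  _
    slot-injective _ _ _ _ () | yes _ | no  _ | yes _

    halfEdgeOf : Edge G → Fin 2 → Fin n × Fin 2
    halfEdgeOf e s = endpoint G e s , slot (endpoint G e s) (col c e)

    halfEdge : Fin k × Fin 2 → Fin n × Fin 2
    halfEdge (a , s) = halfEdgeOf (representative a) s

    halfEdge-incident : ∀ a s {v x} → halfEdge (a , s) ≡ (v , x) → IncidentTo G v (representative a)
    halfEdge-incident a s refl = endpoint-incident G _ s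

    halfEdge-slot : ∀ a s {v x} → halfEdge (a , s) ≡ (v , x) → slot v (col c (representative a)) ≡ x
    halfEdge-slot _ _ refl = refl

    halfEdge-color : ∀ a s {v} e → IncidentTo G v e →
      halfEdge (a , s) ≡ (v , slot v (col c e)) → a ≡ col c e
    halfEdge-color a s e v∈e eq = trans (sym (col-representative a))
      (slot-injective _ e (halfEdge-incident a s eq) v∈e (halfEdge-slot a s eq))

    halfEdge-injective : Injective _≡_ _≡_ halfEdge
    halfEdge-injective {a , s} {b , t} eq = same-color a≡b
      where
      a≡b : a ≡ b
      a≡b = trans (halfEdge-color a s (representative b) (endpoint-incident G _ t) eq)
                  (col-representative b)
      same-color : a ≡ b → (a , s) ≡ (b , t)
      same-color refl = cong (a ,_) (endpoint-injective G _ (cong proj₁ eq))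

    colors≤vertices : k ≤ n
    colors≤vertices = ×-injective⇒≤ halfEdge-injective

    module _ (surjective : StrictlySurjective _≡_ halfEdge) where

      representative-col : ∀ e → representative (col c e) ≡ e
      representative-col e = sym (endpoints⊆⇒≡ G covered)
        where
        covered : ∀ s → ∃ λ t → endpoint G (representative (col c e)) t ≡ endpoint G e s
        covered s with surjective (halfEdgeOf e s)
        ... | (b , t) , eq =
          t , subst (λ a → endpoint G (representative a) t ≡ endpoint G e s)
                    (halfEdge-color b t e (endpoint-incident G e s) eq) (cong proj₁ eq)

      halfEdge-surjective⇒rainbow : Injective _≡_ _≡_ (col c)
      halfEdge-surjective⇒rainbow {e} {e′} eq = begin
        e                         ≡⟨ sym (representative-col e) ⟩
        representative (col c e)  ≡⟨ cong representative eq ⟩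
        representative (col c e′) ≡⟨ representative-col e′ ⟩
        e′                        ∎

      halfEdge-surjective⇒atLeastTwoEdges : ∀ v → AtLeastTwo (IncidentTo G v)
      halfEdge-surjective⇒atLeastTwoEdges v
        with (a , s) , eq₀ ← surjective (v , zero)
           | (b , t) , eq₁ ← surjective (v , suc zero) =
        representative a , representative b , distinct ,
        halfEdge-incident a s eq₀ , halfEdge-incident b t eq₁
        where
        distinct : representative a ≢ representative b
        distinct a≡b = contradiction
          (trans (sym (halfEdge-slot a s eq₀))
                 (trans (cong (slot v ∘ col c) a≡b) (halfEdge-slot b t eq₁)))
          λ ()

    rainbow⇒halfEdge-hits : Injective _≡_ _≡_ (col c) → ∀ {v} e → IncidentTo G v e →
      ∃ λ p → halfEdge p ≡ (v , slot v (col c e))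
    rainbow⇒halfEdge-hits rainbow {v} e v∈e with s , ends ← incident⇒endpoint G v∈e =
      (col c e , s) , (begin
        halfEdgeOf (representative (col c e)) s
          ≡⟨ cong (λ e′ → halfEdgeOf e′ s) (rainbow (col-representative (col c e))) ⟩
        halfEdgeOf e s
          ≡⟨ cong (λ u → u , slot u (col c e)) ends ⟩
        (v , slot v (col c e))
          ∎)

    rainbow⇒halfEdge-surjective : Injective _≡_ _≡_ (col c) →
      (∀ v → AtLeastTwo (IncidentTo G v)) → StrictlySurjective _≡_ halfEdge
    rainbow⇒halfEdge-surjective rainbow at-least (v , x)
      with e₁ , e₂ , e₁≢e₂ , v∈e₁ , v∈e₂ ← at-least v
      with Fin2-≢⇒≡⊎≡ (e₁≢e₂ ∘ rainbow ∘ slot-injective e₁ e₂ v∈e₁ v∈e₂) x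
    ... | inj₁ refl = rainbow⇒halfEdge-hits rainbow e₁ v∈e₁
    ... | inj₂ refl = rainbow⇒halfEdge-hits rainbow e₂ v∈e₂

module _ {n : ℕ} (G : Graph n) where

  rainbowColoring : EdgeColoring G (edgeCount G)
  rainbowColoring = record
    { col  = Inverse.to (Edge↔Fin G)
    ; surj = λ a → Inverse.from (Edge↔Fin G) a , Inverse.strictlyInverseˡ (Edge↔Fin G) a
    }

  twoFactor⇒σ≡n : IsTwoFactor G → SigmaIs G n
  twoFactor⇒σ≡n two-factor =
    subst (HasTwoValidColoring G) |E|≡n (rainbowColoring , valid) ,
    λ _ (c , valid′) → colors≤vertices c valid′
    where
    exactlyTwo : ∀ v → ExactlyTwo (IncidentTo G v)
    exactlyTwo v = Equivalence.to (degree≡2⇔ G v) (two-factor v)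
    valid : TwoValid rainbowColoring
    valid = atMostTwoEdges⇒twoValid rainbowColoring (proj₂ ∘ exactlyTwo)
    |E|≡n : edgeCount G ≡ n
    |E|≡n = ≤-antisym (colors≤vertices rainbowColoring valid)
      (×-strictlySurjective⇒≥ (rainbow⇒halfEdge-surjective rainbowColoring valid
        (↔-to-injective (Edge↔Fin G)) (proj₁ ∘ exactlyTwo)))

  σ≡n⇒twoFactor : SigmaIs G n → IsTwoFactor G
  σ≡n⇒twoFactor ((c , valid) , _) v = Equivalence.from (degree≡2⇔ G v)
    ( halfEdge-surjective⇒atLeastTwoEdges c valid surjective v
    , rainbow-twoValid⇒atMostTwoEdges c (halfEdge-surjective⇒rainbow c valid surjective) valid v)
    where
    surjective : StrictlySurjective _≡_ (halfEdge c valid)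
    surjective = ×-injective⇒strictlySurjective (halfEdge-injective c valid)

mainTheorem5 : ∀ (n : ℕ) (G : Graph n) → IsTwoFactor G ⇔ SigmaIs G n
mainTheorem5 n G = mk⇔ (twoFactor⇒σ≡n G) (σ≡n⇒twoFactor G)
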